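{- For every $n\geq 4$, $L(K_n)$ has no proper Galvin orientation with respect to $\chi'(K_n)$.
   Context: A $k$-edge-colouring is an assignment of colours from $\{1,\dots,k\}$ to edges so that adjacent edges get different colours; $\chi'$ is the chromatic index. The line graph $L(G)$ has vertex set $E(G)$, and two edges $e,f$ of $G$ are joined in $L(G)$ by as many edges as the number of ends they share in $G$; each edge of $L(G)$ corresponds to a common incidence of its two ends at a vertex of $G$. Given a partition of $V(G)$ into sets $U$ and $D$ and a $k$-edge-colouring $\varphi$ of $G$, the Galvin orientation of $L(G)$ is defined as follows: for an edge of $L(G)$ with ends $e_1,e_2$, where $\varphi(e_1)<\varphi(e_2)$, corresponding to a common incidence at a vertex $x$ of $G$: if $x\in D$ it is oriented from $e_2$ to $e_1$, and if $x\in U$ it is oriented from $e_1$ to $e_2$. A kernel of a digraph is an independent set $K$ such that every vertex outside $K$ has an out-edge into $K$; a digraph is kernel-perfect if every induced subdigraph has a kernel. The Galvin orientation is proper if it is kernel-perfect and every vertex has outdegree at most $k-1$. $L(G)$ has a proper Galvin orientation with respect to $k$ if there exist a partition $(U,D)$ of $V(G)$ and a $k$-edge-colouring $\varphi$ of $G$ whose Galvin orientation is proper. -}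

module Defs where

open import Data.Nat using (ℕ; _≤_; _∸_)
open import Data.Fin using (Fin) renaming (_<_ to _<ᶠ_)
open import Data.Bool using (Bool; true; false)
open import Data.Product using (Σ; Σ-syntax; _×_; proj₁; proj₂)
open import Data.Sum using (_⊎_)
open import Data.List using (List; length)
open import Data.List.Relation.Unary.All using (All)
open import Data.List.Relation.Unary.Unique.Propositional using (Unique)
open import Relation.Binary.PropositionalEquality using (_≡_; _≢_)
open import Relation.Nullary using (¬_)

-- Edges of the complete graph K_n on vertex set Fin n:
-- an edge {i,j} is represented uniquely as a pair (i , j) with i < j.
Edge : ℕ → Set
Edge n = Σ[ p ∈ (Fin n × Fin n) ] (proj₁ p <ᶠ proj₂ p)

IsEnd : ∀ {n} → Fin n → Edge n → Set
IsEnd x e = (x ≡ proj₁ (proj₁ e)) ⊎ (x ≡ proj₂ (proj₁ e))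

Adjacent : ∀ {n} → Edge n → Edge n → Set
Adjacent e f = (e ≢ f) × (Σ[ x ∈ _ ] (IsEnd x e × IsEnd x f))

-- k-edge-colouring of K_n with colours Fin k (colours 0..k-1 stand for 1..k)
IsEdgeColouring : ∀ {n k} → (Edge n → Fin k) → Set
IsEdgeColouring φ = ∀ e f → Adjacent e f → φ e ≢ φ f

HasEdgeColouring : ℕ → ℕ → Set
HasEdgeColouring n k = Σ[ φ ∈ (Edge _ → Fin k) ] IsEdgeColouring {n} φ

IsChromaticIndex : ℕ → ℕ → Set
IsChromaticIndex n k = HasEdgeColouring n k × (∀ m → HasEdgeColouring n m → k ≤ m)

-- A partition (U , D) of V(K_n): side x ≡ true means x ∈ U, false means x ∈ D.
-- Galvin orientation of L(K_n): arc from e to f.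
-- (In K_n two distinct edges share at most one end, so L(K_n) is simple.)
GalvinArc : ∀ {n k} → (Fin n → Bool) → (Edge n → Fin k) → Edge n → Edge n → Set
GalvinArc side φ e f =
  (e ≢ f) × (Σ[ x ∈ _ ] (IsEnd x e × IsEnd x f ×
     (((side x ≡ false) × (φ f <ᶠ φ e)) ⊎ ((side x ≡ true) × (φ e <ᶠ φ f)))))

IsKernel : ∀ {V : Set} → (V → V → Set) → (V → Bool) → (V → Bool) → Set
IsKernel {V} A S K =
  (∀ v → K v ≡ true → S v ≡ true) ×
  (∀ v w → K v ≡ true → K w ≡ true → ¬ A v w) ×
  (∀ v → S v ≡ true → K v ≡ false → Σ[ w ∈ V ] ((K w ≡ true) × A v w))

KernelPerfect : ∀ {V : Set} → (V → V → Set) → Set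
KernelPerfect {V} A = ∀ (S : V → Bool) → Σ[ K ∈ (V → Bool) ] IsKernel A S K

OutdegreeAtMost : ∀ {V : Set} → (V → V → Set) → ℕ → Set
OutdegreeAtMost {V} A d =
  ∀ (v : V) (ws : List V) → Unique ws → All (A v) ws → length ws ≤ d

HasProperGalvinOrientation : ℕ → ℕ → Set
HasProperGalvinOrientation n k =
  Σ[ side ∈ (Fin n → Bool) ] Σ[ φ ∈ (Edge n → Fin k) ]
    (IsEdgeColouring φ ×
     KernelPerfect (GalvinArc side φ) ×
     OutdegreeAtMost (GalvinArc side φ) (k ∸ 1))

module Submission where

-- Write χ'(K_n) = T + 1.  A proper Galvin orientation is recorded as a colour
-- table: the side (U or D) of every vertex and the colour c x y ∈ {0..T} of
-- every edge.  Kernel-perfectness forbids directed triangles, so the edge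
-- joining the two same-side vertices of a triangle is never coloured strictly
-- between the other two; the out-degree bound T limits the edges lying above
-- an edge inside U, or below an edge inside D, at its ends.  Exchanging U and
-- D while reversing the colours (flip) preserves all of this.
--
-- As χ'(K_4) = 3 and χ'(K_n) ≤ n, either T + 2 ≤ n, when every vertex sees
-- every colour, or T + 1 = n ≥ 5, when every vertex misses exactly one.  In
-- both regimes the out-degree bound excludes colour 0 inside U and colour T
-- inside D, whence a triangle argument shows that some vertex of U misses 0
-- or some vertex of D misses T.  In the first regime this is absurd at once;
-- in the second a vertex of U missing 0 forces a rigid square with colours
-- 1, T − 1, 1, T − 1, around which a fifth vertex would wind, against the
-- triangle condition.

open import Defs
open import Data.Nat using (ℕ; _≤_)
open import Relation.Nullary using (¬_)

open import Level using (0ℓ)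
open import Function using (_∘_; Equivalence)
open import Data.Empty using (⊥; ⊥-elim)
open import Data.Product using (∃; _×_; _,_; proj₁; proj₂)
open import Data.Product.Properties using (≡-dec)
open import Data.Sum using (_⊎_; inj₁; inj₂)
open import Data.Bool using (Bool; true; false; not)
open import Data.Bool.Properties using (not-injective; ¬-not; T-≡)
open import Data.Nat using (zero; suc; _+_; _∸_; _<_; z≤n; s≤s; s≤s⁻¹; _<?_; _%_; NonZero)
  renaming (_≟_ to _≟ℕ_)
open import Data.Nat.Properties
open import Data.Nat.DivMod using (%-distribˡ-+; [m+n]%n≡m%n; m<n⇒m%n≡m; m%n<n)
open import Data.Nat.Tactic.RingSolver using (solve-∀)
open import Data.Fin as Fin using (Fin; toℕ) renaming (_<_ to _<ᶠ_)
open import Data.Fin.Properties using (injective⇒≤; any?; toℕ-injective; toℕ<n)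
  renaming (_≟_ to _≟ᶠ_)
import Data.Fin.Properties as FinP
open import Data.List using (List; []; _∷_; length; lookup; filter; map; _++_; allFin; upTo)
open import Data.List.Properties using (length-++; length-map; length-tabulate; length-upTo)
open import Data.List.Relation.Unary.Any using (here; there; index)
open import Data.List.Relation.Unary.All as All using (All; []; _∷_)
open import Data.List.Relation.Unary.All.Properties using (map⁺; ++⁺)
open import Data.List.Relation.Unary.AllPairs using ([]; _∷_)
open import Data.List.Relation.Unary.Unique.Propositional using (Unique)
import Data.List.Relation.Unary.Unique.Propositional.Properties as Unique
open import Data.List.Relation.Binary.Subset.Propositional using (_⊆_)
open import Data.List.Membership.Propositional using (_∈_; _∉_)
open import Data.List.Membership.Propositional.Properties
  using (∈-lookup; ∈-allFin; ∈-filter⁺; ∈-filter⁻; ∈-++⁺ˡ; ∈-++⁺ʳ; ∈-++⁻; ∈-map⁻; ∈-upTo⁺)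
open import Data.List.Membership.Setoid.Properties using (index-injective)
import Data.List.Membership.DecPropositional as DecMembership
open import Relation.Nullary using (Dec; yes; no; ¬?; _×-dec_; contradiction)
open import Relation.Nullary.Decidable using (isYes; toWitness; fromWitness; decidable-stable; _→-dec_)
open import Relation.Unary using (Pred; Decidable)
open import Relation.Binary using (DecidableEquality; tri<; tri≈; tri>)
open import Relation.Binary.PropositionalEquality
  using (_≡_; _≢_; refl; sym; trans; cong; cong₂; subst; setoid; ≢-sym; module ≡-Reasoning)

lookup-injective : ∀ {A : Set} {xs : List A} → Unique xs →
                   ∀ i j → lookup xs i ≡ lookup xs j → i ≡ j
lookup-injective (_ ∷ _)    Fin.zero    Fin.zero    _  = refl
lookup-injective (x∉ ∷ _)   Fin.zero    (Fin.suc j) eq = ⊥-elim (All.lookup x∉ (∈-lookup j) eq)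
lookup-injective (x∉ ∷ _)   (Fin.suc i) Fin.zero    eq = ⊥-elim (All.lookup x∉ (∈-lookup i) (sym eq))
lookup-injective (_ ∷ uxs)  (Fin.suc i) (Fin.suc j) eq = cong Fin.suc (lookup-injective uxs i j eq)

unique-⊆-length : ∀ {A : Set} {xs ys : List A} → Unique xs → xs ⊆ ys → length xs ≤ length ys
unique-⊆-length {A} {xs} uxs xs⊆ys = injective⇒≤ position-injective
  where
  position : Fin (length xs) → Fin _
  position i = index (xs⊆ys (∈-lookup i))
  position-injective : ∀ {i j} → position i ≡ position j → i ≡ j
  position-injective {i} {j} eq =
    lookup-injective uxs i j (index-injective (setoid A) (xs⊆ys (∈-lookup i)) (xs⊆ys (∈-lookup j)) eq)

map-unique : ∀ {A B : Set} (f : A → B) {xs : List A} →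
             (∀ {a b} → a ∈ xs → b ∈ xs → f a ≡ f b → a ≡ b) → Unique xs → Unique (map f xs)
map-unique f {[]}     _   []          = []
map-unique f {x ∷ xs} inj (x∉xs ∷ u) =
  map⁺ (All.tabulate λ y∈xs fx≡fy → All.lookup x∉xs y∈xs (inj (here refl) (there y∈xs) fx≡fy))
  ∷ map-unique f (λ a∈ b∈ → inj (there a∈) (there b∈)) u

count : ∀ {n} {P : Pred (Fin n) 0ℓ} → Decidable P → ℕ
count {n} P? = length (filter P? (allFin n))

count-covering : ∀ {n} {P : Pred (Fin n) 0ℓ} (P? : Decidable P) (L : List (Fin n)) →
                 (∀ w → P w ⊎ w ∈ L) → n ≤ count P? + length L
count-covering {n} P? L cover = begin
  n                                     ≡⟨ length-tabulate (λ i → i) ⟨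
  length (allFin n)                     ≤⟨ unique-⊆-length (Unique.allFin⁺ n) allFin⊆ ⟩
  length (filter P? (allFin n) ++ L)    ≡⟨ length-++ (filter P? (allFin n)) ⟩
  count P? + length L                   ∎
  where
  open ≤-Reasoning
  allFin⊆ : allFin n ⊆ filter P? (allFin n) ++ L
  allFin⊆ {w} _ with cover w
  ... | inj₁ pw  = ∈-++⁺ˡ (∈-filter⁺ P? (∈-allFin w) pw)
  ... | inj₂ w∈L = ∈-++⁺ʳ _ w∈L

_∈ᶠ?_ : ∀ {n} (w : Fin n) (L : List (Fin n)) → Dec (w ∈ L)
_∈ᶠ?_ = DecMembership._∈?_ _≟ᶠ_

count-mono : ∀ {n} {P Q : Pred (Fin n) 0ℓ} (P? : Decidable P) (Q? : Decidable Q) →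
             (∀ w → P w → Q w) → count P? ≤ count Q?
count-mono {n} P? Q? P⇒Q =
  unique-⊆-length (Unique.filter⁺ P? (Unique.allFin⁺ n)) λ w∈ →
    let (w∈allFin , pw) = ∈-filter⁻ P? {xs = allFin n} w∈ in ∈-filter⁺ Q? w∈allFin (P⇒Q _ pw)

fresh : ∀ {n} (L : List (Fin n)) → length L < n → ∃ λ w → w ∉ L
fresh {n} L short with any? (λ w → ¬? (w ∈ᶠ? L))
... | yes found = found
... | no  none  = ⊥-elim (<-irrefl refl (<-≤-trans short (begin
  n                  ≡⟨ length-tabulate (λ i → i) ⟨
  length (allFin n)  ≤⟨ unique-⊆-length (Unique.allFin⁺ n) (λ {w} _ → in-L w) ⟩
  length L           ∎)))
  where
  open ≤-Reasoning
  in-L : ∀ w → w ∈ L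
  in-L w = decidable-stable (w ∈ᶠ? L) (λ w∉L → none (w , w∉L))

-- In a digraph without loops and
-- 2-cycles, a directed triangle p → q → r → p induces a subdigraph with no
-- kernel; so a kernel-perfect digraph of this kind has no directed triangle.
module Triangles {V : Set} (A : V → V → Set)
  (irreflexive : ∀ v → ¬ A v v) (asymmetric : ∀ u v → A u v → ¬ A v u) where

  OneOf : V → V → V → V → Set
  OneOf p q r v = v ∈ p ∷ q ∷ r ∷ []

  rotate : ∀ {p q r v} → OneOf p q r v → OneOf q r p v
  rotate (here e)                 = there (there (here e))
  rotate (there (here e))         = here e
  rotate (there (there (here e))) = there (here e)

  -- A kernel K of the subdigraph on {p, q, r} cannot contain p: then q ∉ K
  -- (as p → q), so q needs an out-neighbour in K; but q → p contradicts
  -- asymmetry, q → q irreflexivity, and r ∈ K independence (as r → p).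
  kernel-avoids : ∀ {p q r S K} → A p q → A r p → (∀ v → S v ≡ true → OneOf p q r v) →
                  S q ≡ true → IsKernel A S K → K p ≢ true
  kernel-avoids {p} {q} {r} {K = K} pq rp onlyPQR q∈S (K⊆S , independent , absorbing) p∈K
    with K q in q∈K?
  ... | true  = independent p q p∈K q∈K? pq
  ... | false with absorbing q q∈S q∈K?
  ...   | w , w∈K , qw with onlyPQR w (K⊆S w w∈K)
  ...     | here refl                 = asymmetric p q pq qw
  ...     | there (here refl)         = irreflexive q qw
  ...     | there (there (here refl)) = independent r p w∈K p∈K rp

  -- Hence {p, q, r} has no kernel: by rotation no triangle vertex lies in K,
  -- yet p ∉ K must be absorbed by a kernel vertex among p, q, r.
  triangle-kernel-free : ∀ {p q r S K} → A p q → A q r → A r p →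
                         (∀ v → S v ≡ true → OneOf p q r v) →
                         S p ≡ true → S q ≡ true → S r ≡ true → ¬ IsKernel A S K
  triangle-kernel-free {p} {K = K} pq qr rp onlyPQR p∈S q∈S r∈S kernel@(K⊆S , _ , absorbing)
    with K p in p∈K?
  ... | true  = kernel-avoids pq rp onlyPQR q∈S kernel p∈K?
  ... | false with absorbing p p∈S p∈K?
  ...   | w , w∈K , pw with onlyPQR w (K⊆S w w∈K)
  ...     | here refl                 = irreflexive p pw
  ...     | there (here refl)         =
            kernel-avoids qr pq (λ v → rotate ∘ onlyPQR v) r∈S kernel w∈K
  ...     | there (there (here refl)) =
            kernel-avoids rp qr (λ v → rotate ∘ rotate ∘ onlyPQR v) p∈S kernel w∈K

  -- With decidable equality the triangle is a subset S, whose kernel is absurd.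
  no-triangle : DecidableEquality V → KernelPerfect A → ∀ p q r → A p q → A q r → A r p → ⊥
  no-triangle _≟_ kernelPerfect p q r pq qr rp =
    triangle-kernel-free pq qr rp onlyPQR (inS (here refl)) (inS (there (here refl)))
      (inS (there (there (here refl)))) (proj₂ (kernelPerfect S))
    where
    open DecMembership _≟_ using (_∈?_)
    S : V → Bool
    S v = isYes (v ∈? p ∷ q ∷ r ∷ [])
    inS : ∀ {v} → OneOf p q r v → S v ≡ true
    inS v∈pqr = Equivalence.to T-≡ (fromWitness v∈pqr)
    onlyPQR : ∀ v → S v ≡ true → OneOf p q r v
    onlyPQR v v∈S = toWitness (Equivalence.from T-≡ v∈S)

different-sides : ∀ {p q : Bool} → p ≡ false → q ≡ true → p ≢ q
different-sides refl refl ()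

module _ {n : ℕ} (c : Fin n → Fin n → ℕ) where

  Above Below : Fin n → Fin n → Pred (Fin n) 0ℓ
  Above x y w = w ≢ x × w ≢ y × c x y < c x w
  Below x y w = w ≢ x × w ≢ y × c x w < c x y

  above? : ∀ x y → Decidable (Above x y)
  above? x y w = ¬? (w ≟ᶠ x) ×-dec ¬? (w ≟ᶠ y) ×-dec c x y <? c x w

  below? : ∀ x y → Decidable (Below x y)
  below? x y w = ¬? (w ≟ᶠ x) ×-dec ¬? (w ≟ᶠ y) ×-dec c x w <? c x y

-- A proper Galvin orientation of L(K_n) with colours 0..T is
-- recorded by the side of every vertex (true = U, false = D) and the colour
-- c x y of every edge xy (the diagonal values c x x play no role).  Besides
-- being a symmetric proper colouring, the table inherits two constraints
-- from the orientation: kernel-perfectness forbids certain triangles, and the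
-- out-degree bound limits the edges above (in U) or below (in D) an edge.
record GalvinTable (n T : ℕ) : Set where
  field
    side      : Fin n → Bool
    c         : Fin n → Fin n → ℕ
    bounded   : ∀ x y → c x y ≤ T
    symmetric : ∀ x y → c x y ≡ c y x
    proper    : ∀ x a b → a ≢ x → b ≢ x → a ≢ b → c x a ≢ c x b
    -- a triangle abd with a on the other side from b and d, coloured
    -- c a b < c b d < c a d, would be a directed triangle in L(K_n)
    no-bad-triangle : ∀ a b d → a ≢ b → a ≢ d → b ≢ d → side b ≡ side d → side a ≢ side b →
                      c a b < c b d → c b d < c a d → ⊥
    -- an edge xy inside U has an arc to every edge above it at x or at y;
    -- inside D, to every edge below it
    outdegree-U : ∀ x y → x ≢ y → side x ≡ true → side y ≡ true →
                  count (above? c x y) + count (above? c y x) ≤ T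
    outdegree-D : ∀ x y → x ≢ y → side x ≡ false → side y ≡ false →
                  count (below? c x y) + count (below? c y x) ≤ T

-- The symmetry of the whole situation: exchanging U and D and reversing the
-- colours (a ↦ T ∸ a) yields again a colour table.  Facts about colour 0
-- in U thereby transfer to colour T in D.
flip : ∀ {n T} → GalvinTable n T → GalvinTable n T
flip {n} {T} t = record
  { side            = not ∘ side
  ; c               = c′
  ; bounded         = λ x y → m∸n≤m T (c x y)
  ; symmetric       = λ x y → cong (T ∸_) (symmetric x y)
  ; proper          = λ x a b ax bx ab eq →
                        proper x a b ax bx ab (∸-cancelˡ-≡ (bounded x a) (bounded x b) eq)
  ; no-bad-triangle = λ a b d ab ad bd sbd sab ab<bd bd<ad →
                        no-bad-triangle a d b ad ab (≢-sym bd) (sym (not-injective sbd))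
                          (λ sad → sab (cong not (trans sad (sym (not-injective sbd)))))
                          (subst (c a d <_) (symmetric b d) (∸-cancelʳ-< bd<ad))
                          (subst (_< c a b) (symmetric b d) (∸-cancelʳ-< ab<bd))
  ; outdegree-U     = λ x y xy sx sy → ≤-trans
                        (+-mono-≤ (count-mono _ _ (above⇒below x y)) (count-mono _ _ (above⇒below y x)))
                        (outdegree-D x y xy (not-injective sx) (not-injective sy))
  ; outdegree-D     = λ x y xy sx sy → ≤-trans
                        (+-mono-≤ (count-mono _ _ (below⇒above x y)) (count-mono _ _ (below⇒above y x)))
                        (outdegree-U x y xy (not-injective sx) (not-injective sy))
  }
  where
  open GalvinTable t
  c′ : Fin n → Fin n → ℕ
  c′ x y = T ∸ c x y
  above⇒below : ∀ x y w → Above c′ x y w → Below c x y w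
  above⇒below x y w (wx , wy , lt) = wx , wy , ∸-cancelʳ-< lt
  below⇒above : ∀ x y w → Below c′ x y w → Above c x y w
  below⇒above x y w (wx , wy , lt) = wx , wy , ∸-cancelʳ-< lt

module Colours {n T : ℕ} (t : GalvinTable n T) where
  open GalvinTable t

  avoid : ∀ {q p v k} → v ≢ q → p ≢ q → v ≢ p → c q p ≡ k → c q v ≢ k
  avoid {q} {p} {v} vq pq vp cqp≡k cqv≡k = proper q v p vq pq vp (trans cqv≡k (sym cqp≡k))

  Misses Sees : Fin n → ℕ → Set
  Misses x a = ∀ w → w ≢ x → c x w ≢ a
  Sees   x a = ∃ λ w → w ≢ x × c x w ≡ a

  sees-or-misses : ∀ x a → Sees x a ⊎ Misses x a
  sees-or-misses x a with any? (λ w → ¬? (w ≟ᶠ x) ×-dec c x w ≟ℕ a)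
  ... | yes seen = inj₁ seen
  ... | no  none = inj₂ λ w wx cxw≡a → none (w , wx , cxw≡a)

  -- At most one neighbour o of x is joined to it by colour a (if there is
  -- none, o = x serves).  Needed where "all but one edge" are counted.
  only-neighbour : ∀ x a → ∃ λ o → ∀ w → w ≢ x → w ≢ o → c x w ≢ a
  only-neighbour x a with sees-or-misses x a
  ... | inj₁ (o , ox , cxo≡a) = o , λ w wx wo → avoid wx ox wo cxo≡a
  ... | inj₂ misses           = x , λ w wx _ → misses w wx

  others : Fin n → List (Fin n)
  others x = filter (λ w → ¬? (w ≟ᶠ x)) (allFin n)

  others-length : ∀ x → n ≤ length (others x) + 1
  others-length x = count-covering (λ w → ¬? (w ≟ᶠ x)) (x ∷ []) cover
    where
    cover : ∀ w → w ≢ x ⊎ w ∈ x ∷ []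
    cover w with w ≟ᶠ x
    ... | yes w≡x = inj₂ (here w≡x)
    ... | no  w≢x = inj₁ w≢x

  -- Colour counting at x: the n - 1 colours seen at x and a list M of
  -- distinct colours missed at x are all distinct colours in 0..T.
  missing-colours : ∀ x (M : List ℕ) → Unique M → All (Misses x) M → All (_≤ T) M →
                    n + length M ≤ 2 + T
  missing-colours x M uM missed M≤T = begin
    n + length M                          ≤⟨ +-monoˡ-≤ (length M) (others-length x) ⟩
    length (others x) + 1 + length M      ≡⟨ cong (_+ length M) (+-comm (length (others x)) 1) ⟩
    1 + (length (others x) + length M)    ≡⟨ cong (λ m → 1 + (m + length M)) (length-map (c x) (others x)) ⟨
    1 + (length seen + length M)          ≡⟨ cong suc (length-++ seen) ⟨
    1 + length (seen ++ M)                ≤⟨ s≤s (unique-⊆-length unique within) ⟩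
    1 + length (upTo (suc T))             ≡⟨ cong suc (length-upTo (suc T)) ⟩
    2 + T                                 ∎
    where
    open ≤-Reasoning
    seen : List ℕ
    seen = map (c x) (others x)
    other : ∀ {w} → w ∈ others x → w ≢ x
    other w∈ = proj₂ (∈-filter⁻ (λ w → ¬? (w ≟ᶠ x)) {xs = allFin n} w∈)
    unique : Unique (seen ++ M)
    unique = Unique.++⁺
      (map-unique (c x) (λ a∈ b∈ eq → decidable-stable (_ ≟ᶠ _) (λ a≢b → proper x _ _ (other a∈) (other b∈) a≢b eq))
        (Unique.filter⁺ _ (Unique.allFin⁺ n)))
      uM
      (λ (a∈seen , a∈M) → let (w , w∈ , a≡cxw) = ∈-map⁻ (c x) a∈seen
                           in All.lookup missed a∈M w (other w∈) (sym a≡cxw))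
    within : seen ++ M ⊆ upTo (suc T)
    within a∈ with ∈-++⁻ seen a∈
    ... | inj₁ a∈seen = let (w , _ , a≡cxw) = ∈-map⁻ (c x) a∈seen
                        in ∈-upTo⁺ (s≤s (subst (_≤ T) (sym a≡cxw) (bounded x w)))
    ... | inj₂ a∈M    = ∈-upTo⁺ (s≤s (All.lookup M≤T a∈M))

  sees-every-colour : 2 + T ≤ n → ∀ x a → a ≤ T → ¬ Misses x a
  sees-every-colour room x a a≤T misses = ≤⇒≯ room (subst (_≤ 2 + T) (+-comm n 1)
    (missing-colours x (a ∷ []) ([] ∷ []) (misses ∷ []) (a≤T ∷ [])))

  misses-at-most-one : 1 + T ≤ n → ∀ x a b → a ≢ b → a ≤ T → b ≤ T → Misses x a → Sees x b
  misses-at-most-one room x a b a≢b a≤T b≤T missesA with sees-or-misses x b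
  ... | inj₁ seesB   = seesB
  ... | inj₂ missesB = ⊥-elim (≤⇒≯ room (s≤s⁻¹ (subst (_≤ 2 + T) (+-comm n 2)
        (missing-colours x (a ∷ b ∷ []) ((a≢b ∷ []) ∷ [] ∷ []) (missesA ∷ missesB ∷ []) (a≤T ∷ b≤T ∷ [])))))

  count-above : ∀ x y (L : List (Fin n)) → (∀ w → w ≢ x → w ≢ y → w ∉ L → c x y < c x w) →
                n ≤ count (above? c x y) + (2 + length L)
  count-above x y L above = count-covering (above? c x y) (x ∷ y ∷ L) cover
    where
    cover : ∀ w → Above c x y w ⊎ w ∈ x ∷ y ∷ L
    cover w with w ∈ᶠ? (x ∷ y ∷ L)
    ... | yes w∈ = inj₂ w∈
    ... | no  w∉ = inj₁ (w∉ ∘ here , w∉ ∘ there ∘ here ,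
                         above w (w∉ ∘ here) (w∉ ∘ there ∘ here) (w∉ ∘ there ∘ there))

  crowded-U : ∀ x y → x ≢ y → side x ≡ true → side y ≡ true → (Lx Ly : List (Fin n)) →
              (∀ w → w ≢ x → w ≢ y → w ∉ Lx → c x y < c x w) →
              (∀ w → w ≢ y → w ≢ x → w ∉ Ly → c y x < c y w) →
              n + n ≤ T + (4 + (length Lx + length Ly))
  crowded-U x y xy sx sy Lx Ly aboveX aboveY = begin
    n + n                                     ≤⟨ +-mono-≤ (count-above x y Lx aboveX) (count-above y x Ly aboveY) ⟩
    (cx + (2 + length Lx)) + (cy + (2 + length Ly)) ≡⟨ regroup cx cy (length Lx) (length Ly) ⟩
    (cx + cy) + (4 + (length Lx + length Ly)) ≤⟨ +-monoˡ-≤ _ (outdegree-U x y xy sx sy) ⟩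
    T + (4 + (length Lx + length Ly))         ∎
    where
    open ≤-Reasoning
    cx : ℕ
    cx = count (above? c x y)
    cy : ℕ
    cy = count (above? c y x)
    regroup : ∀ a b l m → (a + (2 + l)) + (b + (2 + m)) ≡ (a + b) + (4 + (l + m))
    regroup = solve-∀

  above-0 : ∀ {x y w} → c x y ≡ 0 → c x w ≢ 0 → c x y < c x w
  above-0 {x} {w = w} cxy≡0 cxw≢0 = subst (_< c x w) (sym cxy≡0) (n≢0⇒n>0 cxw≢0)

  above-1 : ∀ {x y w} → c x y ≡ 1 → c x w ≢ 0 → c x w ≢ 1 → c x y < c x w
  above-1 {x} {w = w} cxy≡1 cxw≢0 cxw≢1 = subst (_< c x w) (sym cxy≡1) (≤∧≢⇒< (n≢0⇒n>0 cxw≢0) (≢-sym cxw≢1))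

  -- The triangle condition in usable form: in a triangle abd with a on the
  -- other side from b and d, the edge bd is never coloured strictly between
  -- ab and ad, so if it lies above (below) one of them it lies above (below)
  -- the other as well.
  stays-above : ∀ {a b d} → a ≢ b → a ≢ d → b ≢ d → side b ≡ side d → side a ≢ side b →
                c a b < c b d → c a d < c b d
  stays-above {a} {b} {d} ab ad bd sbd sab ab<bd with <-cmp (c a d) (c b d)
  ... | tri< ad<bd _ _ = ad<bd
  ... | tri≈ _ ad≡bd _ = ⊥-elim (proper d a b ad bd ab
                           (trans (symmetric d a) (trans ad≡bd (symmetric b d))))
  ... | tri> _ _ bd<ad = ⊥-elim (no-bad-triangle a b d ab ad bd sbd sab ab<bd bd<ad)

  stays-below : ∀ {a b d} → a ≢ b → a ≢ d → b ≢ d → side b ≡ side d → side a ≢ side b →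
                c b d < c a b → c b d < c a d
  stays-below {a} {b} {d} ab ad bd sbd sab bd<ab with <-cmp (c b d) (c a d)
  ... | tri< bd<ad _ _ = bd<ad
  ... | tri≈ _ bd≡ad _ = ⊥-elim (proper d b a bd ad (≢-sym ab)
                           (trans (symmetric d b) (trans bd≡ad (symmetric a d))))
  ... | tri> _ _ ad<bd = ⊥-elim (no-bad-triangle a d b ad ab (≢-sym bd) (sym sbd) (λ sad → sab (trans sad (sym sbd)))
                           (subst (c a d <_) (symmetric b d) ad<bd) (subst (_< c a b) (symmetric b d) bd<ab))

  -- A 4-cycle q₀ q₁ q₂ q₃ alternating between the sides, with q₁ and q₃ on
  -- the side of a further vertex v, cannot have each edge q₁q₂, q₃q₀ above
  -- and each edge q₀q₁, q₂q₃ below the spoke to v at their common end: by the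
  -- triangle condition the spoke colours c q₀ v < c q₁ v < c q₂ v < c q₃ v
  -- < c q₀ v would increase all the way round the cycle.
  no-winding-square : ∀ {q₀ q₁ q₂ q₃ v} →
    q₀ ≢ q₁ → q₁ ≢ q₂ → q₂ ≢ q₃ → q₃ ≢ q₀ → q₀ ≢ v → q₁ ≢ v → q₂ ≢ v → q₃ ≢ v →
    side q₁ ≡ side v → side q₃ ≡ side v → side q₀ ≢ side v → side q₂ ≢ side v →
    c q₀ q₁ < c q₁ v → c q₁ v < c q₁ q₂ → c q₂ q₃ < c q₃ v → c q₃ v < c q₃ q₀ → ⊥
  no-winding-square {q₀} {q₁} {q₂} {q₃} {v} q01 q12 q23 q30 q0v q1v q2v q3v σ₁ σ₃ σ₀ σ₂ lo₁ hi₁ lo₃ hi₃ =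
    <-irrefl refl (<-trans q₀<q₁ (<-trans q₁<q₂ (<-trans q₂<q₃ q₃<q₀)))
    where
    q₀<q₁ : c q₀ v < c q₁ v
    q₀<q₁ = stays-above q01 q0v q1v σ₁ (λ e → σ₀ (trans e σ₁)) lo₁
    q₁<q₂ : c q₁ v < c q₂ v
    q₁<q₂ = stays-below (≢-sym q12) q2v q1v σ₁ (λ e → σ₂ (trans e σ₁)) (subst (c q₁ v <_) (symmetric q₁ q₂) hi₁)
    q₂<q₃ : c q₂ v < c q₃ v
    q₂<q₃ = stays-above q23 q2v q3v σ₃ (λ e → σ₂ (trans e σ₃)) lo₃
    q₃<q₀ : c q₃ v < c q₀ v
    q₃<q₀ = stays-below (≢-sym q30) q0v q3v σ₃ (λ e → σ₀ (trans e σ₃)) (subst (c q₃ v <_) (symmetric q₃ q₀) hi₃)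

-- Then an edge inside U
-- cannot have almost all edges at its ends above it; this rules out the
-- bottom colours inside U and, by flipping, the top colours inside D.
module Dense {n T : ℕ} (t : GalvinTable n T) (dense : T + 5 < n + n) where
  open GalvinTable t
  open Colours t

  -- An edge of colour 0 inside U has all 2(n − 2) other edges at its ends above it.
  no-bottom-in-U : ∀ x y → x ≢ y → side x ≡ true → side y ≡ true → c x y ≢ 0
  no-bottom-in-U x y xy sx sy cxy≡0 =
    ≤⇒≯ (crowded-U x y xy sx sy [] [] aboveX aboveY) (<-trans (+-monoʳ-< T ≤-refl) dense)
    where
    aboveX : ∀ w → w ≢ x → w ≢ y → w ∉ [] → c x y < c x w
    aboveX w wx wy _ = above-0 cxy≡0 (avoid wx (≢-sym xy) wy cxy≡0)
    aboveY : ∀ w → w ≢ y → w ≢ x → w ∉ [] → c y x < c y w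
    aboveY w wy wx _ = above-0 cyx≡0 (avoid wy xy wx cyx≡0)
      where
      cyx≡0 : c y x ≡ 0
      cyx≡0 = trans (symmetric y x) cxy≡0

  -- If x ∈ U misses colour 0, its edge of colour 1 does not end in U: all
  -- n − 2 other edges at x, and all but at most one at y, would lie above it.
  no-one-in-U : ∀ x y → x ≢ y → side x ≡ true → side y ≡ true → Misses x 0 → c x y ≢ 1
  no-one-in-U x y xy sx sy missesX cxy≡1 with only-neighbour y 0
  ... | o , onlyO = ≤⇒≯ (crowded-U x y xy sx sy [] (o ∷ []) aboveX aboveY) dense
    where
    cyx≡1 : c y x ≡ 1
    cyx≡1 = trans (symmetric y x) cxy≡1
    aboveX : ∀ w → w ≢ x → w ≢ y → w ∉ [] → c x y < c x w
    aboveX w wx wy _ = above-1 cxy≡1 (missesX w wx) (avoid wx (≢-sym xy) wy cxy≡1)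
    aboveY : ∀ w → w ≢ y → w ≢ x → w ∉ o ∷ [] → c y x < c y w
    aboveY w wy wx w∉ = above-1 cyx≡1 (onlyO w wy (w∉ ∘ here)) (avoid wy xy wx cyx≡1)

module FlipColours {n T : ℕ} (t : GalvinTable n T) where
  open GalvinTable t
  open Colours t
  private module Flipped = Colours (flip t)

  misses-top⇒flipped-bottom : ∀ x → Misses x T → Flipped.Misses x 0
  misses-top⇒flipped-bottom x missesT w wx T∸cxw≡0 =
    missesT w wx (≤-antisym (bounded x w) (m∸n≡0⇒m≤n T∸cxw≡0))

  flipped-top⇒misses-bottom : ∀ x → Flipped.Misses x T → Misses x 0
  flipped-top⇒misses-bottom x missesT w wx cxw≡0 = missesT w wx (cong (T ∸_) cxw≡0)

-- In a dense table in which every vertex of U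
-- sees colour 0 and every vertex of D sees colour T, take y ∈ D, its
-- T-neighbour x (necessarily in U) and the 0-neighbour z of x (necessarily
-- in D): the triangle xzy has c x z = 0 < c z y, so c x y = T < c z y.
module Extremes {n T : ℕ} (t : GalvinTable n T) (dense : T + 5 < n + n) where
  open GalvinTable t
  open Colours t
  open Dense t dense
  private module Flipped = Dense (flip t) dense

  no-top-in-D : ∀ x y → x ≢ y → side x ≡ false → side y ≡ false → c x y ≢ T
  no-top-in-D x y xy sx sy cxy≡T =
    Flipped.no-bottom-in-U x y xy (cong not sx) (cong not sy) (trans (cong (T ∸_) cxy≡T) (n∸n≡0 T))

  -- Some vertex lies in D: a vertex of U sees colour 0, and that edge ends in D.
  some-D : Fin n → (∀ x → side x ≡ true → ¬ Misses x 0) → ∃ λ y → side y ≡ false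
  some-D v seesBottom with side v in sv
  ... | false = v , sv
  ... | true with sees-or-misses v 0
  ...   | inj₂ missesV       = ⊥-elim (seesBottom v sv missesV)
  ...   | inj₁ (w , wv , cvw≡0) with side w in sw
  ...     | false = w , sw
  ...     | true  = ⊥-elim (no-bottom-in-U v w (≢-sym wv) sv sw cvw≡0)

  extremes-seen⇒⊥ : 0 < T → Fin n → (∀ x → side x ≡ true → ¬ Misses x 0) →
                    (∀ x → side x ≡ false → ¬ Misses x T) → ⊥
  extremes-seen⇒⊥ T>0 v seesBottom seesTop with some-D v seesBottom
  ... | y , sy with sees-or-misses y T
  ...   | inj₂ missesY = seesTop y sy missesY
  ...   | inj₁ (x , xy , cyx≡T) with side x in sx
  ...     | false = no-top-in-D y x (≢-sym xy) sy sx cyx≡T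
  ...     | true with sees-or-misses x 0
  ...       | inj₂ missesX = seesBottom x sx missesX
  ...       | inj₁ (z , zx , cxz≡0) with side z in sz
  ...         | true  = no-bottom-in-U x z (≢-sym zx) sx sz cxz≡0
  ...         | false = <⇒≱ (stays-above (≢-sym zx) xy zy (trans sz (sym sy)) (≢-sym (different-sides sz sx))
                                (subst (_< c z y) (symmetric z x) (above-0 czx≡0 czy≢0)))
                            (subst (c z y ≤_) (sym cxy≡T) (bounded z y))
    where
    cxy≡T : c x y ≡ T
    cxy≡T = trans (symmetric x y) cyx≡T
    zy : z ≢ y
    zy refl = <⇒≢ T>0 (trans (sym cxz≡0) cxy≡T)
    czx≡0 : c z x ≡ 0
    czx≡0 = trans (symmetric z x) cxz≡0
    czy≢0 : c z y ≢ 0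
    czy≢0 = avoid (≢-sym zy) (≢-sym zx) (≢-sym xy) czx≡0

-- The odd case n = T + 1 = 5 + r, in which every vertex misses exactly one
-- colour and the colours 0 < 1 < 3 + r < 4 + r = T play special roles.
-- Such tables are dense.
odd-dense : ∀ r → (4 + r) + 5 < (5 + r) + (5 + r)
odd-dense r = begin-strict
  (4 + r) + 5        ≡⟨ regroup r ⟩
  9 + r              <⟨ ≤-refl ⟩
  10 + r             ≤⟨ m≤m+n (10 + r) r ⟩
  (10 + r) + r       ≡⟨ regroup′ r ⟩
  (5 + r) + (5 + r)  ∎
  where
  open ≤-Reasoning
  regroup : ∀ r → (4 + r) + 5 ≡ 9 + r
  regroup = solve-∀
  regroup′ : ∀ r → (10 + r) + r ≡ (5 + r) + (5 + r)
  regroup′ = solve-∀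

-- The first step from a vertex of U missing 0 (kept apart so that OddCase
-- can also use it on the flipped table).
module StepUp {r : ℕ} (t : GalvinTable (5 + r) (4 + r)) where
  open GalvinTable t
  open Colours t
  open Dense t (odd-dense r)
  open Extremes t (odd-dense r)

  -- A vertex x ∈ U missing colour 0 sees colour 1 (it misses only one
  -- colour), along an edge xz with z ∈ D (no-one-in-U), and z misses T: its
  -- T-neighbour w could be neither x (colour 1), nor in D (no-top-in-D), nor
  -- in U, where the triangle zxw with c z x = 1 < c x w would force
  -- T = c z w < c x w.
  step-up : ∀ x → side x ≡ true → Misses x 0 →
            ∃ λ z → z ≢ x × c x z ≡ 1 × side z ≡ false × Misses z (4 + r)
  step-up x sx missesX with misses-at-most-one ≤-refl x 0 1 (λ ()) z≤n (s≤s z≤n) missesX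
  ... | z , zx , cxz≡1 with side z in sz
  ...   | true  = ⊥-elim (no-one-in-U x z (≢-sym zx) sx sz missesX cxz≡1)
  ...   | false with sees-or-misses z (4 + r)
  ...     | inj₂ missesZ         = z , zx , cxz≡1 , sz , missesZ
  ...     | inj₁ (w , wz , czw≡T) = ⊥-elim (no-top-neighbour w wz czw≡T)
    where
    czx≡1 : c z x ≡ 1
    czx≡1 = trans (symmetric z x) cxz≡1
    no-top-neighbour : ∀ w → w ≢ z → c z w ≡ 4 + r → ⊥
    no-top-neighbour w wz czw≡T with w ≟ᶠ x
    ... | yes refl = contradiction (trans (sym czx≡1) czw≡T) λ ()
    ... | no  wx with side w in sw
    ...   | false = no-top-in-D z w (≢-sym wz) sz sw czw≡T
    ...   | true  = <⇒≱ (stays-above zx (≢-sym wz) (≢-sym wx) (trans sx (sym sw)) (different-sides sz sx) zx<xw)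
                        (subst (c x w ≤_) (sym czw≡T) (bounded x w))
      where
      zx<xw : c z x < c x w
      zx<xw = subst (_< c x w) (symmetric x z) (above-1 cxz≡1 (missesX w wx) (avoid wx zx wz cxz≡1))

module OddCase {r : ℕ} (t : GalvinTable (5 + r) (4 + r)) where
  open GalvinTable t
  open Colours t
  open FlipColours t
  open StepUp t using (step-up)
  private module Flipped = StepUp (flip t)

  T : ℕ
  T = 4 + r

  -- The flip of step-up: a vertex z ∈ D missing T has its edge of colour
  -- 3 + r = T ∸ 1 going to some w ∈ U that misses 0.
  step-down : ∀ z → side z ≡ false → Misses z T →
              ∃ λ w → w ≢ z × c z w ≡ 3 + r × side w ≡ true × Misses w 0
  step-down z sz missesZ with Flipped.step-up z (cong not sz) (misses-top⇒flipped-bottom z missesZ)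
  ... | w , wz , T∸czw≡1 , sw , missesW =
    w , wz , trans (sym (m∸[m∸n]≡n (bounded z w))) (cong (T ∸_) T∸czw≡1) ,
    not-injective sw , flipped-top⇒misses-bottom w missesW

  middle : ∀ {a} → a ≤ T → a ≢ 0 → a ≢ 1 → a ≢ 3 + r → a ≢ T → 1 < a × a < 3 + r
  middle a≤T a≢0 a≢1 a≢s a≢T =
    ≤∧≢⇒< (n≢0⇒n>0 a≢0) (≢-sym a≢1) , ≤∧≢⇒< (s≤s⁻¹ (≤∧≢⇒< a≤T a≢T)) a≢s

  -- Starting from x ∈ U missing 0 with x –1– z ∈ D and z –(3+r)– w ∈ U, the
  -- path closes with x –T– w: c x w is none of 0, 1, 3 + r, and a value
  -- below 3 + r would make c z w = 3 + r < c x w in the triangle zxw.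
  closing : ∀ {x z w} → side x ≡ true → Misses x 0 → z ≢ x → c x z ≡ 1 → side z ≡ false →
            w ≢ z → c z w ≡ 3 + r → side w ≡ true → w ≢ x × c x w ≡ T
  closing {x} {z} {w} sx missesX zx cxz≡1 sz wz czw≡s sw = wx , cxw≡T
    where
    czx≡1 : c z x ≡ 1
    czx≡1 = trans (symmetric z x) cxz≡1
    wx : w ≢ x
    wx refl = contradiction (trans (sym czx≡1) czw≡s) λ ()
    cxw≢s : c x w ≢ 3 + r
    cxw≢s cxw≡s = avoid (≢-sym wx) (≢-sym wz) (≢-sym zx) (trans (symmetric w z) czw≡s)
                    (trans (symmetric w x) cxw≡s)
    zx<xw : c z x < c x w
    zx<xw = subst (_< c x w) (symmetric x z) (above-1 cxz≡1 (missesX w wx) (avoid wx zx wz cxz≡1))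
    zw<xw : c z w < c x w
    zw<xw = stays-above zx (≢-sym wz) (≢-sym wx) (trans sx (sym sw)) (different-sides sz sx) zx<xw
    cxw≡T : c x w ≡ T
    cxw≡T with <-cmp (c x w) (3 + r)
    ... | tri< xw<s _ _ = ⊥-elim (<-asym xw<s (subst (_< c x w) czw≡s zw<xw))
    ... | tri≈ _ xw≡s _ = ⊥-elim (cxw≢s xw≡s)
    ... | tri> _ _ s<xw = ≤-antisym (bounded x w) s<xw

  record Square : Set where
    field
      x z w z′  : Fin (5 + r)
      z≢x       : z ≢ x
      w≢z       : w ≢ z
      z′≢w      : z′ ≢ w
      x≢z′      : x ≢ z′
      w≢x       : w ≢ x
      z≢z′      : z ≢ z′
      sx        : side x ≡ true
      sw        : side w ≡ true
      sz        : side z ≡ false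
      sz′       : side z′ ≡ false
      missesX   : Misses x 0
      missesW   : Misses w 0
      missesZ   : Misses z T
      missesZ′  : Misses z′ T
      cxz≡1     : c x z ≡ 1
      czw≡s     : c z w ≡ 3 + r
      cwz′≡1    : c w z′ ≡ 1
      cz′x≡s    : c z′ x ≡ 3 + r
      cxw≡T     : c x w ≡ T
      czz′≡0    : c z z′ ≡ 0

  -- Two rounds of step-up and step-down from x close up into a square: the
  -- second round returns to x, as c w w′ = T = c w x forces w′ = x.  The
  -- diagonal zz′ has colour 0: otherwise c x z = 1 < c z z′ would give
  -- 3 + r = c x z′ < c z z′ in the triangle xzz′, i.e. c z z′ = T, which z misses.
  square : ∀ x → side x ≡ true → Misses x 0 → Square
  square x sx missesX
    with z  , zx  , cxz≡1  , sz  , missesZ  ← step-up x sx missesX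
    with w  , wz  , czw≡s  , sw  , missesW  ← step-down z sz missesZ
    with z′ , z′w , cwz′≡1 , sz′ , missesZ′ ← step-up w sw missesW
    with w′ , w′z′ , cz′w′≡s , sw′ , _      ← step-down z′ sz′ missesZ′
    with wx  , cxw≡T  ← closing sx missesX zx cxz≡1 sz wz czw≡s sw
    with w′w , cww′≡T ← closing sw missesW z′w cwz′≡1 sz′ w′z′ cz′w′≡s sw′
    with w′ ≟ᶠ x
  ... | no w′x    = ⊥-elim (avoid w′w (≢-sym wx) w′x (trans (symmetric w x) cxw≡T) cww′≡T)
  ... | yes refl  = record
    { x = x ; z = z ; w = w ; z′ = z′
    ; z≢x = zx ; w≢z = wz ; z′≢w = z′w ; x≢z′ = w′z′ ; w≢x = wx ; z≢z′ = zz′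
    ; sx = sx ; sw = sw ; sz = sz ; sz′ = sz′
    ; missesX = missesX ; missesW = missesW ; missesZ = missesZ ; missesZ′ = missesZ′
    ; cxz≡1 = cxz≡1 ; czw≡s = czw≡s ; cwz′≡1 = cwz′≡1 ; cz′x≡s = cz′w′≡s ; cxw≡T = cxw≡T
    ; czz′≡0 = diagonal
    }
    where
    zz′ : z ≢ z′
    zz′ refl = contradiction (trans (sym (trans (symmetric w z) czw≡s)) cwz′≡1) λ ()
    diagonal : c z z′ ≡ 0
    diagonal with c z z′ ≟ℕ 0
    ... | yes zz′≡0 = zz′≡0
    ... | no  zz′≢0 = ⊥-elim (missesZ z′ (≢-sym zz′)
                          (≤-antisym (bounded z z′) (subst (_< c z z′) cxz′≡s xz′<zz′)))
      where
      czx≡1 : c z x ≡ 1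
      czx≡1 = trans (symmetric z x) cxz≡1
      cxz′≡s : c x z′ ≡ 3 + r
      cxz′≡s = trans (symmetric x z′) cz′w′≡s
      xz<zz′ : c x z < c z z′
      xz<zz′ = subst (_< c z z′) (symmetric z x)
                 (above-1 czx≡1 zz′≢0 (avoid (≢-sym zz′) (≢-sym zx) (≢-sym w′z′) czx≡1))
      xz′<zz′ : c x z′ < c z z′
      xz′<zz′ = stays-above (≢-sym zx) w′z′ zz′ (trans sz (sym sz′)) (≢-sym (different-sides sz sx)) xz<zz′

  -- A fifth vertex v sees every corner in a colour
  -- strictly between 1 and 3 + r, since each corner uses up 0, 1, 3 + r and
  -- T on the other corners or misses them; then the square winds around v,
  -- as the cycle z x z′ w if v ∈ U and as x z w z′ if v ∈ D.
  no-square : Square → ⊥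
  no-square sq with fresh (x ∷ z ∷ w ∷ z′ ∷ []) (s≤s (s≤s (s≤s (s≤s (s≤s z≤n)))))
    where open Square sq
  ... | v , v∉ = winds (side v) refl
    where
    open Square sq
    vx : v ≢ x
    vx = v∉ ∘ here
    vz : v ≢ z
    vz = v∉ ∘ there ∘ here
    vw : v ≢ w
    vw = v∉ ∘ there ∘ there ∘ here
    vz′ : v ≢ z′
    vz′ = v∉ ∘ there ∘ there ∘ there ∘ here
    czx≡1 : c z x ≡ 1
    czx≡1 = trans (symmetric z x) cxz≡1
    cxz′≡s : c x z′ ≡ 3 + r
    cxz′≡s = trans (symmetric x z′) cz′x≡s
    cwz≡s : c w z ≡ 3 + r
    cwz≡s = trans (symmetric w z) czw≡s
    cz′w≡1 : c z′ w ≡ 1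
    cz′w≡1 = trans (symmetric z′ w) cwz′≡1
    spoke-x : 1 < c x v × c x v < 3 + r
    spoke-x = middle (bounded x v) (missesX v vx) (avoid vx z≢x vz cxz≡1)
                (avoid vx (≢-sym x≢z′) vz′ cxz′≡s) (avoid vx w≢x vw cxw≡T)
    spoke-w : 1 < c w v × c w v < 3 + r
    spoke-w = middle (bounded w v) (missesW v vw) (avoid vw z′≢w vz′ cwz′≡1)
                (avoid vw (≢-sym w≢z) vz cwz≡s) (avoid vw (≢-sym w≢x) vx (trans (symmetric w x) cxw≡T))
    spoke-z : 1 < c z v × c z v < 3 + r
    spoke-z = middle (bounded z v) (avoid vz (≢-sym z≢z′) vz′ czz′≡0) (avoid vz (≢-sym z≢x) vx czx≡1)
                (avoid vz w≢z vw czw≡s) (missesZ v vz)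
    spoke-z′ : 1 < c z′ v × c z′ v < 3 + r
    spoke-z′ = middle (bounded z′ v) (avoid vz′ z≢z′ vz (trans (symmetric z′ z) czz′≡0))
                 (avoid vz′ (≢-sym z′≢w) vw cz′w≡1) (avoid vz′ x≢z′ vx cz′x≡s) (missesZ′ v vz′)
    winds : ∀ σ → side v ≡ σ → ⊥
    winds true sv = no-winding-square z≢x x≢z′ z′≢w w≢z
      (≢-sym vz) (≢-sym vx) (≢-sym vz′) (≢-sym vw)
      (trans sx (sym sv)) (trans sw (sym sv)) (different-sides sz sv) (different-sides sz′ sv)
      (subst (_< c x v) (sym czx≡1) (proj₁ spoke-x)) (subst (c x v <_) (sym cxz′≡s) (proj₂ spoke-x))
      (subst (_< c w v) (sym cz′w≡1) (proj₁ spoke-w)) (subst (c w v <_) (sym cwz≡s) (proj₂ spoke-w))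
    winds false sv = no-winding-square (≢-sym z≢x) (≢-sym w≢z) (≢-sym z′≢w) (≢-sym x≢z′)
      (≢-sym vx) (≢-sym vz) (≢-sym vw) (≢-sym vz′)
      (trans sz (sym sv)) (trans sz′ (sym sv)) (≢-sym (different-sides sv sx)) (≢-sym (different-sides sv sw))
      (subst (_< c z v) (sym cxz≡1) (proj₁ spoke-z)) (subst (c z v <_) (sym czw≡s) (proj₂ spoke-z))
      (subst (_< c z′ v) (sym cwz′≡1) (proj₁ spoke-z′)) (subst (c z′ v <_) (sym cz′x≡s) (proj₂ spoke-z′))

  U-sees-bottom : ∀ x → side x ≡ true → ¬ Misses x 0
  U-sees-bottom x sx missesX = no-square (square x sx missesX)

-- Edges of K_n.  For i ≢ j, edge i j is the edge with ends i and j; on the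
-- diagonal it returns a fixed default edge d₀, a value never used.
module Edges {n : ℕ} (d₀ : Edge n) where

  edge : Fin n → Fin n → Edge n
  edge i j with FinP.<-cmp i j
  ... | tri< i<j _ _ = (i , j) , i<j
  ... | tri≈ _ _ _   = d₀
  ... | tri> _ _ j<i = (j , i) , j<i

  edge-≡ : ∀ {i j} (p q : i <ᶠ j) → _≡_ {A = Edge n} ((i , j) , p) ((i , j) , q)
  edge-≡ p q = cong (_ ,_) (FinP.<-irrelevant p q)

  _≟ᴱ_ : DecidableEquality (Edge n)
  _≟ᴱ_ = ≡-dec (≡-dec _≟ᶠ_ _≟ᶠ_) (λ p q → yes (FinP.<-irrelevant p q))

  edge-sym : ∀ i j → edge i j ≡ edge j i
  edge-sym i j with FinP.<-cmp i j | FinP.<-cmp j i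
  ... | tri< i<j _ _  | tri> _ _ i<j′ = edge-≡ i<j i<j′
  ... | tri< i<j _ _  | tri< j<i _ _  = ⊥-elim (FinP.<-asym i<j j<i)
  ... | tri< i<j _ _  | tri≈ _ j≡i _  = ⊥-elim (FinP.<⇒≢ i<j (sym j≡i))
  ... | tri≈ _ _ _    | tri≈ _ _ _    = refl
  ... | tri≈ _ i≡j _  | tri< j<i _ _  = ⊥-elim (FinP.<⇒≢ j<i (sym i≡j))
  ... | tri≈ _ i≡j _  | tri> _ _ i<j  = ⊥-elim (FinP.<⇒≢ i<j i≡j)
  ... | tri> _ _ j<i  | tri< j<i′ _ _ = edge-≡ j<i j<i′
  ... | tri> _ _ j<i  | tri≈ _ j≡i _  = ⊥-elim (FinP.<⇒≢ j<i j≡i)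
  ... | tri> _ _ j<i  | tri> _ _ i<j  = ⊥-elim (FinP.<-asym i<j j<i)

  end-left : ∀ {i j} → i ≢ j → IsEnd i (edge i j)
  end-left {i} {j} i≢j with FinP.<-cmp i j
  ... | tri< _ _ _   = inj₁ refl
  ... | tri≈ _ i≡j _ = ⊥-elim (i≢j i≡j)
  ... | tri> _ _ _   = inj₂ refl

  end-right : ∀ {i j} → i ≢ j → IsEnd j (edge i j)
  end-right {i} {j} i≢j = subst (IsEnd j) (edge-sym j i) (end-left (≢-sym i≢j))

  ends : ∀ {i j x} → i ≢ j → IsEnd x (edge i j) → x ≡ i ⊎ x ≡ j
  ends {i} {j} i≢j x-end with FinP.<-cmp i j
  ends i≢j (inj₁ x≡i) | tri< _ _ _ = inj₁ x≡i
  ends i≢j (inj₂ x≡j) | tri< _ _ _ = inj₂ x≡j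
  ends i≢j _          | tri≈ _ i≡j _ = ⊥-elim (i≢j i≡j)
  ends i≢j (inj₁ x≡j) | tri> _ _ _ = inj₂ x≡j
  ends i≢j (inj₂ x≡i) | tri> _ _ _ = inj₁ x≡i

  not-edge : ∀ {e i j x} → i ≢ j → x ≢ i → x ≢ j → IsEnd x e → e ≢ edge i j
  not-edge i≢j x≢i x≢j x-end refl with ends i≢j x-end
  ... | inj₁ x≡i = x≢i x≡i
  ... | inj₂ x≡j = x≢j x≡j

  edge-canonical : ∀ {a b} (a<b : a <ᶠ b) → ((a , b) , a<b) ≡ edge a b
  edge-canonical {a} {b} a<b with FinP.<-cmp a b
  ... | tri< a<b′ _ _ = edge-≡ a<b a<b′
  ... | tri≈ _ a≡b _  = ⊥-elim (FinP.<⇒≢ a<b a≡b)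
  ... | tri> _ _ b<a  = ⊥-elim (FinP.<-asym a<b b<a)

  other-end : ∀ {e x} → IsEnd x e → ∃ λ o → o ≢ x × e ≡ edge x o
  other-end {(a , b) , a<b} (inj₁ refl) = b , ≢-sym (FinP.<⇒≢ a<b) , edge-canonical a<b
  other-end {(a , b) , a<b} (inj₂ refl) = a , FinP.<⇒≢ a<b , trans (edge-canonical a<b) (edge-sym a b)

  edge-injective : ∀ {x a b} → a ≢ x → b ≢ x → edge x a ≡ edge x b → a ≡ b
  edge-injective {x} {a} {b} a≢x b≢x eq with ends (≢-sym b≢x) (subst (IsEnd a) eq (end-right (≢-sym a≢x)))
  ... | inj₁ a≡x = ⊥-elim (a≢x a≡x)
  ... | inj₂ a≡b = a≡b

  edge-through : ∀ {e x y} → x ≢ y → IsEnd x e → IsEnd y e → e ≡ edge x y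
  edge-through {e} {x} {y} x≢y x-end y-end with other-end x-end
  ... | o , o≢x , e≡xo with ends (≢-sym o≢x) (subst (IsEnd y) e≡xo y-end)
  ...   | inj₁ y≡x = ⊥-elim (x≢y (sym y≡x))
  ...   | inj₂ y≡o = trans e≡xo (cong (edge x) (sym y≡o))

-- A proper Galvin orientation of L(K_n) with T + 1 colours yields a colour
-- table: the colouring is proper and symmetric by construction, the
-- triangle condition comes from kernel-perfectness (a bad triangle spans a
-- directed 3-cycle), and the out-degree bound from the arcs leaving an edge
-- inside U or D towards the edges above or below it at its ends.
module FromOrientation {n T : ℕ} (d₀ : Edge n) (side : Fin n → Bool) (φ : Edge n → Fin (suc T))
  (colouring : IsEdgeColouring φ) (kernel-perfect : KernelPerfect (GalvinArc side φ))
  (outdegree : OutdegreeAtMost (GalvinArc side φ) T) where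
  open Edges d₀

  Arc : Edge n → Edge n → Set
  Arc = GalvinArc side φ

  c : Fin n → Fin n → ℕ
  c x y = toℕ (φ (edge x y))

  -- Galvin arcs are never reciprocal: distinct edges of K_n sharing two
  -- ends would coincide, and at a single common end the order of the two
  -- colours fixes the direction.
  arc-asymmetric : ∀ e f → Arc e f → ¬ Arc f e
  arc-asymmetric e f (e≢f , x , x-e , x-f , dir) (_ , y , y-f , y-e , dir′) with x ≟ᶠ y
  ... | no  x≢y = e≢f (trans (edge-through x≢y x-e y-e) (sym (edge-through x≢y x-f y-f)))
  ... | yes refl with dir | dir′
  ...   | inj₁ (_ , f<e)  | inj₁ (_ , e<f)   = <-asym f<e e<f
  ...   | inj₂ (_ , e<f)  | inj₂ (_ , f<e)   = <-asym f<e e<f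
  ...   | inj₁ (sx , _)   | inj₂ (sx′ , _)   = different-sides sx sx′ refl
  ...   | inj₂ (sx′ , _)  | inj₁ (sx , _)    = different-sides sx sx′ refl

  arc-irreflexive : ∀ e → ¬ Arc e e
  arc-irreflexive e (e≢e , _) = e≢e refl

  open Triangles Arc arc-irreflexive arc-asymmetric using (no-triangle)

  proper : ∀ x a b → a ≢ x → b ≢ x → a ≢ b → c x a ≢ c x b
  proper x a b a≢x b≢x a≢b ca≡cb =
    colouring (edge x a) (edge x b)
      ((λ eq → a≢b (edge-injective a≢x b≢x eq)) , x , end-left (≢-sym a≢x) , end-left (≢-sym b≢x))
      (toℕ-injective ca≡cb)

  -- In a bad triangle abd the three edges form a directed 3-cycle, in one
  -- direction or the other according to the side of a.
  no-bad-triangle : ∀ a b d → a ≢ b → a ≢ d → b ≢ d → side b ≡ side d → side a ≢ side b →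
                    c a b < c b d → c b d < c a d → ⊥
  no-bad-triangle a b d a≢b a≢d b≢d sbd sab ab<bd bd<ad = cycle (side a) refl
    where
    ab≢ad : edge a b ≢ edge a d
    ab≢ad = ≢-sym (not-edge a≢b (≢-sym a≢d) (≢-sym b≢d) (end-right a≢d))
    ab≢bd : edge a b ≢ edge b d
    ab≢bd = ≢-sym (not-edge a≢b (≢-sym a≢d) (≢-sym b≢d) (end-right b≢d))
    bd≢ad : edge b d ≢ edge a d
    bd≢ad = ≢-sym (not-edge b≢d a≢b a≢d (end-left a≢d))
    cycle : ∀ σ → side a ≡ σ → ⊥
    cycle true  sa = no-triangle _≟ᴱ_ kernel-perfect (edge a b) (edge a d) (edge b d)
      (ab≢ad , a , end-left a≢b , end-left a≢d , inj₂ (sa , <-trans ab<bd bd<ad))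
      (≢-sym bd≢ad , d , end-right a≢d , end-right b≢d , inj₁ (trans (sym sbd) sb , bd<ad))
      (≢-sym ab≢bd , b , end-left b≢d , end-right a≢b , inj₁ (sb , ab<bd))
      where
      sb : side b ≡ false
      sb = trans (¬-not (≢-sym sab)) (cong not sa)
    cycle false sa = no-triangle _≟ᴱ_ kernel-perfect (edge a b) (edge b d) (edge a d)
      (ab≢bd , b , end-right a≢b , end-left b≢d , inj₂ (sb , ab<bd))
      (bd≢ad , d , end-right b≢d , end-right a≢d , inj₂ (trans (sym sbd) sb , bd<ad))
      (≢-sym ab≢ad , a , end-left a≢d , end-left a≢b , inj₁ (sa , <-trans ab<bd bd<ad))
      where
      sb : side b ≡ true
      sb = trans (¬-not (≢-sym sab)) (cong not sa)

  -- Out-neighbours of the edge xy among the edges xw (w ∈ P) and yw (w ∈ Q)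
  -- are pairwise distinct, so their number is at most the out-degree T.
  out-count : ∀ x y → x ≢ y → {P Q : Pred (Fin n) 0ℓ} (P? : Decidable P) (Q? : Decidable Q) →
              (∀ {w} → P w → w ≢ x × Arc (edge x y) (edge x w)) →
              (∀ {w} → Q w → w ≢ y × w ≢ x × Arc (edge x y) (edge y w)) →
              count P? + count Q? ≤ T
  out-count x y x≢y P? Q? atX atY = begin
    count P? + count Q?                       ≡⟨ cong₂ _+_ (length-map (edge x) Lx) (length-map (edge y) Ly) ⟨
    length (map (edge x) Lx) + length (map (edge y) Ly) ≡⟨ length-++ (map (edge x) Lx) ⟨
    length ws                                 ≤⟨ outdegree (edge x y) ws unique arcs ⟩
    T                                         ∎
    where
    open ≤-Reasoning
    Lx : List (Fin n)
    Lx = filter P? (allFin n)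
    Ly : List (Fin n)
    Ly = filter Q? (allFin n)
    ws : List (Edge n)
    ws = map (edge x) Lx ++ map (edge y) Ly
    inP : ∀ {w} → w ∈ Lx → w ≢ x × Arc (edge x y) (edge x w)
    inP w∈ = atX (proj₂ (∈-filter⁻ P? {xs = allFin n} w∈))
    inQ : ∀ {w} → w ∈ Ly → w ≢ y × w ≢ x × Arc (edge x y) (edge y w)
    inQ w∈ = atY (proj₂ (∈-filter⁻ Q? {xs = allFin n} w∈))
    unique : Unique ws
    unique = Unique.++⁺
      (map-unique (edge x) (λ a∈ b∈ → edge-injective (proj₁ (inP a∈)) (proj₁ (inP b∈)))
        (Unique.filter⁺ P? (Unique.allFin⁺ n)))
      (map-unique (edge y) (λ a∈ b∈ → edge-injective (proj₁ (inQ a∈)) (proj₁ (inQ b∈)))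
        (Unique.filter⁺ Q? (Unique.allFin⁺ n)))
      λ (e∈x , e∈y) → let (w  , w∈  , e≡xw)  = ∈-map⁻ (edge x) e∈x
                          (w′ , w′∈ , e≡yw′) = ∈-map⁻ (edge y) e∈y
                      in not-edge (≢-sym (proj₁ (inQ w′∈))) x≢y (≢-sym (proj₁ (proj₂ (inQ w′∈))))
                           (subst (IsEnd x) (sym e≡xw) (end-left (≢-sym (proj₁ (inP w∈))))) e≡yw′
    arcs : All (Arc (edge x y)) ws
    arcs = ++⁺ (map⁺ (All.tabulate (proj₂ ∘ inP))) (map⁺ (All.tabulate (proj₂ ∘ proj₂ ∘ inQ)))

  table : GalvinTable n T
  table = record
    { side            = side
    ; c               = c
    ; bounded         = λ x y → s≤s⁻¹ (toℕ<n (φ (edge x y)))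
    ; symmetric       = λ x y → cong (toℕ ∘ φ) (edge-sym x y)
    ; proper          = proper
    ; no-bad-triangle = no-bad-triangle
    ; outdegree-U     = λ x y x≢y sx sy → out-count x y x≢y (above? c x y) (above? c y x)
        (λ (w≢x , w≢y , above) → w≢x , arc-at-x x≢y w≢x w≢y (inj₂ (sx , above)))
        (λ (w≢y , w≢x , above) → w≢y , w≢x , arc-at-y x≢y w≢x w≢y (inj₂ (sy , above)))
    ; outdegree-D     = λ x y x≢y sx sy → out-count x y x≢y (below? c x y) (below? c y x)
        (λ (w≢x , w≢y , below) → w≢x , arc-at-x x≢y w≢x w≢y (inj₁ (sx , below)))
        (λ (w≢y , w≢x , below) → w≢y , w≢x , arc-at-y x≢y w≢x w≢y (inj₁ (sy , below)))
    }
    where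
    arc-at-x : ∀ {x y w} → x ≢ y → w ≢ x → w ≢ y →
               (side x ≡ false × c x w < c x y) ⊎ (side x ≡ true × c x y < c x w) →
               Arc (edge x y) (edge x w)
    arc-at-x x≢y w≢x w≢y dir =
      (λ eq → w≢y (sym (edge-injective (≢-sym x≢y) w≢x eq))) , _ , end-left x≢y , end-left (≢-sym w≢x) , dir
    arc-at-y : ∀ {x y w} → x ≢ y → w ≢ x → w ≢ y →
               (side y ≡ false × c y w < c y x) ⊎ (side y ≡ true × c y x < c y w) →
               Arc (edge x y) (edge y w)
    arc-at-y {x} {y} {w} x≢y w≢x w≢y dir = subst (λ e → Arc e (edge y w)) (edge-sym y x)
      (arc-at-x (≢-sym x≢y) w≢y w≢x dir)

-- With T + 2 ≤ n
-- every vertex sees every colour; with T + 1 = n ≥ 5 the odd-case analysis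
-- shows that U sees 0 and, flipping, that D sees T.  Either way the table is
-- dense and Extremes applies.
no-table : ∀ {m T} → GalvinTable (4 + m) T → 2 + T ≤ 4 + m ⊎ (suc T ≡ 4 + m × 5 ≤ 4 + m) → ⊥
no-table {m} {T} t (inj₁ room) =
  extremes-seen⇒⊥ T>0 Fin.zero (λ x _ → sees-every-colour room x 0 z≤n) (λ x _ → sees-every-colour room x T ≤-refl)
  where
  open Colours t
  -- the four vertices need at least three colours
  T>0 : 0 < T
  T>0 = ≤-trans (s≤s z≤n) (s≤s⁻¹ (s≤s⁻¹ (missing-colours Fin.zero [] [] [] [])))
  dense : T + 5 < (4 + m) + (4 + m)
  dense = begin-strict
    T + 5             <⟨ ≤-reflexive (regroup T) ⟩
    (2 + T) + 4       ≤⟨ +-mono-≤ room (m≤m+n 4 m) ⟩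
    (4 + m) + (4 + m) ∎
    where
    open ≤-Reasoning
    regroup : ∀ T → suc (T + 5) ≡ (2 + T) + 4
    regroup = solve-∀
  open Extremes t dense using (extremes-seen⇒⊥)
no-table {zero} t (inj₂ (refl , s≤s (s≤s (s≤s (s≤s ())))))
no-table {suc r} t (inj₂ (refl , _)) =
  Extremes.extremes-seen⇒⊥ t (odd-dense r) (s≤s z≤n) Fin.zero (OddCase.U-sees-bottom t) D-sees-top
  where
  D-sees-top : ∀ x → GalvinTable.side t x ≡ false → ¬ Colours.Misses t x (4 + r)
  D-sees-top x sx missesTop =
    OddCase.U-sees-bottom (flip t) x (cong not sx) (FlipColours.misses-top⇒flipped-bottom t x missesTop)

table-colouring : ∀ {n m} (t : Fin n → Fin n → Fin m) → (∀ a b → t a b ≡ t b a) →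
                  (∀ x a b → a ≢ x → b ≢ x → a ≢ b → t x a ≢ t x b) → HasEdgeColouring n m
table-colouring {n} {m} t symmetric row-injective = colour , proper
  where
  colour : Edge n → Fin m
  colour ((a , b) , _) = t a b
  from-end : ∀ {e x} → IsEnd x e → ∃ λ o → o ≢ x × IsEnd o e × colour e ≡ t x o
  from-end {(a , b) , a<b} (inj₁ refl) = b , ≢-sym (FinP.<⇒≢ a<b) , inj₂ refl , refl
  from-end {(a , b) , a<b} (inj₂ refl) = a , FinP.<⇒≢ a<b , inj₁ refl , symmetric a b
  proper : IsEdgeColouring colour
  proper e f (e≢f , x , x-e , x-f) same with from-end {e} x-e | from-end {f} x-f
  ... | o , o≢x , o-e , ce≡txo | o′ , o′≢x , o′-f , cf≡txo′ with o ≟ᶠ o′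
  ...   | no  o≢o′ = row-injective x o o′ o≢x o′≢x o≢o′ (trans (sym ce≡txo) (trans same cf≡txo′))
  ...   | yes refl = e≢f (trans (edge-through (≢-sym o≢x) x-e o-e) (sym (edge-through (≢-sym o≢x) x-f o′-f)))
    where open Edges e using (edge-through)

-- Adding x modulo n is injective on residues: adding n ∸ x undoes it.
+-mod-injective : ∀ {n} .{{_ : NonZero n}} x {a b} → x ≤ n → a < n → b < n →
                  (x + a) % n ≡ (x + b) % n → a ≡ b
+-mod-injective {n} x {a} {b} x≤n a<n b<n eq = begin
  a                                   ≡⟨ undo a<n ⟨
  ((x + a) % n + (n ∸ x) % n) % n     ≡⟨ cong (λ r → (r + (n ∸ x) % n) % n) eq ⟩
  ((x + b) % n + (n ∸ x) % n) % n     ≡⟨ undo b<n ⟩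
  b                                   ∎
  where
  open ≡-Reasoning
  regroup : ∀ x a y → (x + a) + y ≡ a + (x + y)
  regroup = solve-∀
  undo : ∀ {a} → a < n → ((x + a) % n + (n ∸ x) % n) % n ≡ a
  undo {a} a<n = begin
    ((x + a) % n + (n ∸ x) % n) % n   ≡⟨ %-distribˡ-+ (x + a) (n ∸ x) n ⟨
    ((x + a) + (n ∸ x)) % n           ≡⟨ cong (_% n) (regroup x a (n ∸ x)) ⟩
    (a + (x + (n ∸ x))) % n           ≡⟨ cong (λ r → (a + r) % n) (m+[n∸m]≡n x≤n) ⟩
    (a + n) % n                       ≡⟨ [m+n]%n≡m%n a n ⟩
    a % n                             ≡⟨ m<n⇒m%n≡m a<n ⟩
    a                                 ∎

complete-colouring : ∀ n → HasEdgeColouring (suc n) (suc n)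
complete-colouring n = table-colouring t t-symmetric t-row-injective
  where
  t : Fin (suc n) → Fin (suc n) → Fin (suc n)
  t a b = Fin.fromℕ< (m%n<n (toℕ a + toℕ b) (suc n))
  toℕ-t : ∀ a b → toℕ (t a b) ≡ (toℕ a + toℕ b) % suc n
  toℕ-t a b = FinP.toℕ-fromℕ< _
  t-symmetric : ∀ a b → t a b ≡ t b a
  t-symmetric a b = toℕ-injective (trans (toℕ-t a b)
    (trans (cong (_% suc n) (+-comm (toℕ a) (toℕ b))) (sym (toℕ-t b a))))
  t-row-injective : ∀ x a b → a ≢ x → b ≢ x → a ≢ b → t x a ≢ t x b
  t-row-injective x a b _ _ a≢b eq = a≢b (toℕ-injective
    (+-mod-injective (toℕ x) (<⇒≤ (toℕ<n x)) (toℕ<n a) (toℕ<n b)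
      (trans (sym (toℕ-t x a)) (trans (cong toℕ eq) (toℕ-t x b)))))

-- K_4 is 3-edge-colourable, one colour for each of its perfect matchings.
K₄-colouring : HasEdgeColouring 4 3
K₄-colouring = table-colouring matching (λ a b → toWitness {a? = symmetric?} _ a b)
                                        (λ x a b → toWitness {a? = row-injective?} _ x a b)
  where
  matching : Fin 4 → Fin 4 → Fin 3
  matching a b = lookupTable (toℕ a) (toℕ b)
    where
    lookupTable : ℕ → ℕ → Fin 3
    lookupTable 0 1 = Fin.zero
    lookupTable 2 3 = Fin.zero
    lookupTable 1 0 = Fin.zero
    lookupTable 3 2 = Fin.zero
    lookupTable 0 2 = Fin.suc Fin.zero
    lookupTable 1 3 = Fin.suc Fin.zero
    lookupTable 2 0 = Fin.suc Fin.zero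
    lookupTable 3 1 = Fin.suc Fin.zero
    lookupTable _ _ = Fin.suc (Fin.suc Fin.zero)
  symmetric? : Dec (∀ a b → matching a b ≡ matching b a)
  symmetric? = FinP.all? λ a → FinP.all? λ b → matching a b ≟ᶠ matching b a
  row-injective? : Dec (∀ x a b → a ≢ x → b ≢ x → a ≢ b → matching x a ≢ matching x b)
  row-injective? = FinP.all? λ x → FinP.all? λ a → FinP.all? λ b →
    ¬? (a ≟ᶠ x) →-dec ¬? (b ≟ᶠ x) →-dec ¬? (a ≟ᶠ b) →-dec ¬? (matching x a ≟ᶠ matching x b)

-- With k = T + 1 the chromatic index of K_n, n = 4 + m: since k ≤ 3 for
-- n = 4 and k ≤ n in general, either T + 2 ≤ n, or T + 1 = n ≥ 5.
colour-regimes : ∀ m T → (∀ j → HasEdgeColouring (4 + m) j → suc T ≤ j) →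
                 2 + T ≤ 4 + m ⊎ (suc T ≡ 4 + m × 5 ≤ 4 + m)
colour-regimes zero    T minimal = inj₁ (s≤s (minimal 3 K₄-colouring))
colour-regimes (suc r) T minimal with m≤n⇒m<n∨m≡n (minimal (5 + r) (complete-colouring (4 + r)))
... | inj₁ T+1<n = inj₁ T+1<n
... | inj₂ T+1≡n = inj₂ (T+1≡n , s≤s (s≤s (s≤s (s≤s (s≤s z≤n)))))

first-edge : ∀ {m} → Edge (suc (suc m))
first-edge = (Fin.zero , Fin.suc Fin.zero) , s≤s z≤n

theorem5 : ∀ (n : ℕ) → 4 ≤ n → ∀ (k : ℕ) → IsChromaticIndex n k →
           ¬ HasProperGalvinOrientation n k
theorem5 0 () _ _
theorem5 1 (s≤s ()) _ _
theorem5 2 (s≤s (s≤s ())) _ _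
theorem5 3 (s≤s (s≤s (s≤s ()))) _ _
theorem5 (suc (suc (suc (suc m)))) _ zero    _ (_ , φ , _) = FinP.¬Fin0 (φ first-edge)
theorem5 (suc (suc (suc (suc m)))) _ (suc T) (_ , minimal)
         (side , φ , colouring , kernel-perfect , outdegree) =
  no-table (FromOrientation.table first-edge side φ colouring kernel-perfect outdegree)
           (colour-regimes m T minimal)
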